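{- Let $T$ be a tree with at least $2$ vertices and let $b\geq 1$ be an integer. Then the following are equivalent: (i) Dominator has a winning strategy in the $b$-biased Maker-Breaker domination game on $T$ when Staller is the first player; (ii) $T$ is $b$-good.
   Context: The $b$-biased Maker-Breaker domination game on a finite graph $G$: Dominator and Staller alternately claim previously unclaimed vertices of $G$; in each of her turns Dominator claims up to $b$ vertices, in each of his turns Staller claims one vertex. Dominator wins if the set of vertices she claims contains a dominating set of $G$ (a set $D$ such that every vertex outside $D$ has a neighbour in $D$); otherwise Staller wins. For a forest $F$, $L(F)$ denotes its set of leaves (vertices of degree $1$ in $F$); $N(v)$ denotes the neighbourhood of $v$ in $T$. For a sequence $\mathbf v=(v_1,\dots,v_t)$ of distinct vertices of $T$, set $F_0:=T$ and $F_i:=F_{i-1}-(\{v_i\}\cup (N(v_i)\cap L(F_{i-1})))$ for $i=1,\dots,t$, and write $T_{\downarrow \mathbf v}:=F_t$ (for the empty sequence, $T_{\downarrow()}=T$). The sequence $\mathbf v$ is called admissible if $|N(v_i)\cap L(T_{\downarrow(v_1,\dots,v_{i-1})})|=b$ for every $i\in\{1,\dots,t\}$. A sequence $(v_1,\dots,v_t,u)$ is called problematic if $(v_1,\dots,v_t)$ is admissible and $|N(u)\cap L(T_{\downarrow(v_1,\dots,v_t)})|\geq b+1$. The tree $T$ is $b$-good if there is no problematic sequence for $T$. (Informally: one repeatedly deletes a vertex having exactly $b$ leaf neighbours together with those leaf neighbours, and $T$ is $b$-good if this can never produce a vertex with at least $b+1$ leaf neighbours.) -}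

module Defs where

open import Data.Nat using (ℕ; zero; suc; _≤_; _≡ᵇ_)
open import Data.Bool using (Bool; true; false; _∧_; T)
open import Data.Fin using (Fin)
open import Data.Fin.Subset using (Subset; _∈_; _∉_; _⊆_; _∩_; _∪_; _─_; ⁅_⁆; ∣_∣)
  renaming (⊤ to Full; ⊥ to EmptySet)
open import Data.Vec using (tabulate; lookup)
open import Data.List using (List; []; _∷_; length; _∷ʳ_)
open import Data.List.Relation.Unary.Unique.Propositional using (Unique)
open import Data.List.Relation.Unary.Linked using (Linked)
open import Data.Product using (_×_; Σ; ∃; ∃-syntax)
open import Data.Sum using (_⊎_)
open import Data.Unit using () renaming (⊤ to Unit)
open import Relation.Nullary using (¬_)
open import Relation.Binary.PropositionalEquality using (_≡_)

record SimpleGraph (n : ℕ) : Set where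
  field
    adj     : Fin n → Fin n → Bool
    adj-sym : ∀ u v → adj u v ≡ adj v u
    irrefl  : ∀ v → adj v v ≡ false

open SimpleGraph public

module _ {n : ℕ} (G : SimpleGraph n) where

  Adj : Fin n → Fin n → Set
  Adj u v = T (adj G u v)

  data Walk : Fin n → Fin n → Set where
    here : ∀ {v} → Walk v v
    step : ∀ {u w v} → Adj u w → Walk w v → Walk u v

  Connected : Set
  Connected = ∀ u v → Walk u v

  IsCycle : Fin n → List (Fin n) → Set
  IsCycle x ys = (2 ≤ length ys) × Unique (x ∷ ys) × Linked Adj ((x ∷ ys) ∷ʳ x)

  Acyclic : Set
  Acyclic = ∀ x ys → ¬ IsCycle x ys

  IsTree : Set
  IsTree = Connected × Acyclic

  Dominating : Subset n → Set
  Dominating D = ∀ v → v ∉ D → ∃[ u ] (u ∈ D × Adj u v)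

  ContainsDominatingSet : Subset n → Set
  ContainsDominatingSet X = ∃[ D ] (D ⊆ X × Dominating D)

  -- A position is a pair (D , S) of the sets claimed by Dominator and
  -- Staller.  DomWinsS D S : Dominator has a winning strategy from (D , S)
  -- with Staller to move;  DomWinsD D S : likewise with Dominator to move.

  Free : Subset n → Subset n → Fin n → Set
  Free D S v = v ∉ D × v ∉ S

  AllClaimed : Subset n → Subset n → Set
  AllClaimed D S = ∀ v → v ∈ D ⊎ v ∈ S

  module _ (b : ℕ) where
    data DomWinsS : Subset n → Subset n → Set
    data DomWinsD : Subset n → Subset n → Set

    data DomWinsS where
      endS  : ∀ {D S} → AllClaimed D S → ContainsDominatingSet D → DomWinsS D S
      moveS : ∀ {D S} → ¬ AllClaimed D S →
              (∀ v → Free D S v → DomWinsD D (S ∪ ⁅ v ⁆)) → DomWinsS D S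

    data DomWinsD where
      endD  : ∀ {D S} → AllClaimed D S → ContainsDominatingSet D → DomWinsD D S
      moveD : ∀ {D S} → ¬ AllClaimed D S → (X : Subset n) → ∣ X ∣ ≤ b →
              (∀ v → v ∈ X → Free D S v) → DomWinsS (D ∪ X) S → DomWinsD D S

    DominatorWinsStallerStart : Set
    DominatorWinsStallerStart = DomWinsS EmptySet EmptySet

  -- b-good trees.  Forests are induced subgraphs of G given by vertex sets.

  Nbhd : Fin n → Subset n
  Nbhd v = tabulate (adj G v)

  degIn : Subset n → Fin n → ℕ
  degIn F v = ∣ F ∩ Nbhd v ∣

  Leaves : Subset n → Subset n
  Leaves F = tabulate (λ v → lookup F v ∧ (degIn F v ≡ᵇ 1))

  stepF : Subset n → Fin n → Subset n
  stepF F v = F ─ (⁅ v ⁆ ∪ (Nbhd v ∩ Leaves F))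

  reduce : Subset n → List (Fin n) → Subset n
  reduce F []       = F
  reduce F (v ∷ vs) = reduce (stepF F v) vs

  down : List (Fin n) → Subset n
  down vs = reduce Full vs

  module _ (b : ℕ) where
    AdmissibleFrom : Subset n → List (Fin n) → Set
    AdmissibleFrom F []       = Unit
    AdmissibleFrom F (v ∷ vs) = (∣ Nbhd v ∩ Leaves F ∣ ≡ b) × AdmissibleFrom (stepF F v) vs

    Admissible : List (Fin n) → Set
    Admissible vs = Unique vs × AdmissibleFrom Full vs

    Problematic : List (Fin n) → Fin n → Set
    Problematic vs u = Unique (vs ∷ʳ u) × Admissible vs × (suc b ≤ ∣ Nbhd u ∩ Leaves (down vs) ∣)

    Good : Set
    Good = ∀ vs u → ¬ Problematic vs u

-- Staller, moving first, plays along a problematic sequence (v₁, …, v_t, u): he claims vᵢ, and Dominator has to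
-- answer by claiming all b leaf neighbours of vᵢ in the current forest, for a leaf left unclaimed would be claimed by
-- Staller next and could then never be dominated. After t rounds u has at least b + 1 unclaimed leaf neighbours,
-- more than Dominator can claim in one move.
--
-- Conversely, Dominator wins whenever the vertex set splits into stars with at most b rays each: she answers every
-- vertex claimed by Staller by claiming the rest of its star, which always contains a neighbour of it. In a b-good
-- tree such a partition is obtained by first peeling off stars centred at vertices with exactly b leaf neighbours, as
-- long as there are any; afterwards every vertex has fewer than b leaf neighbours, and this is kept while peeling off
-- the star of a vertex p adjacent to leaves and to at most one non-leaf q. The only vertex that can become a new leaf
-- is q; if that would give q's other neighbour b leaf neighbours, q is added to p's star.
module Submission where

open import Defs
open import Data.Bool using (Bool; T)
open import Data.Bool.Properties using (T-≡; T-∧)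
open import Data.Empty using (⊥-elim)
open import Data.Fin using (Fin; zero; suc) renaming (_≟_ to _≟ᶠ_)
open import Data.Fin.Properties using (any?; all?; ¬∀⟶∃¬)
open import Data.Fin.Subset
  using (Subset; _∈_; _∉_; _⊆_; _∩_; _∪_; _─_; ⁅_⁆; ∁; ∣_∣; ⋃; Nonempty; inside; outside)
  renaming (⊤ to Full; ⊥ to ∅)
open import Data.Fin.Subset.Properties
  using ( _∈?_; nonempty?; Empty-unique; ∉⊥; ∈⊤; x∈⁅x⁆; x∈⁅y⁆⇒x≡y; x∉⁅y⁆⇒x≢y; x∉p⇒x∈∁p; x∈∁p⇒x∉p
        ; x∈p∩q⁺; x∈p∩q⁻; x∈p∪q⁺; x∈p∪q⁻; x∈p∧x∉q⇒x∈p─q; p─q⊆p; ⊆-antisym; ∪-assoc; p─q─r≡p─q∪r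
        ; ∣⊥∣≡0; ∣p∣≤n; ∣⁅x⁆∣≡1; p⊆q⇒∣p∣≤∣q∣; p⊂q⇒∣p∣<∣q∣; x∈p⇒∣p-x∣<∣p∣; p∩q≢∅⇒∣p─q∣<∣p∣)
open import Data.List using (List; []; _∷_; _∷ʳ_; length; map)
open import Data.List.Properties using (∷-injective)
open import Data.List.Membership.Propositional using () renaming (_∈_ to _∈ₗ_; _∉_ to _∉ₗ_)
open import Data.List.Relation.Unary.Any using (here; there)
open import Data.List.Relation.Unary.All as All using (All; []; _∷_)
open import Data.List.Relation.Unary.All.Properties using (¬Any⇒All¬)
open import Data.List.Relation.Unary.AllPairs using ([]; _∷_)
open import Data.List.Relation.Unary.Linked using (Linked; []; [-]; _∷_)
open import Data.List.Relation.Unary.Unique.Propositional using (Unique)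
import Data.List.Relation.Unary.Unique.Propositional.Properties as Unique
open import Data.Nat using (ℕ; zero; suc; _+_; _≤_; _<_; z≤n; s≤s)
open import Data.Nat.Properties
open import Data.Product using (_×_; _,_; proj₁; proj₂; ∃-syntax; Σ-syntax)
open import Data.Sum as Sum using (_⊎_; inj₁; inj₂; [_,_]′)
open import Data.Vec using ([]; _∷_; tabulate; here; there)
open import Data.Vec.Properties using (lookup∘tabulate; []=⇒lookup; lookup⇒[]=)
open import Function.Base using (_∘_; id)
open import Function.Bundles using (_⇔_; mk⇔; Equivalence)
open import Relation.Binary.PropositionalEquality
  using (_≡_; _≢_; refl; sym; trans; cong; subst; module ≡-Reasoning)
open import Relation.Nullary using (¬_; Dec; yes; no; contradiction)
open import Relation.Nullary.Decidable using (_×-dec_; _⊎-dec_; ¬?; T?)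

x∈p─q⇒x∉q : ∀ {n} (p q : Subset n) {x} → x ∈ p ─ q → x ∉ q
x∈p─q⇒x∉q (_ ∷ p) (inside  ∷ q) {zero}  ()
x∈p─q⇒x∉q (_ ∷ p) (outside ∷ q) {zero}  _          ()
x∈p─q⇒x∉q (_ ∷ p) (_       ∷ q) {suc x} (there x∈) (there x∈q) = x∈p─q⇒x∉q p q x∈ x∈q

∣p∪q∣≤∣p∣+∣q∣ : ∀ {n} (p q : Subset n) → ∣ p ∪ q ∣ ≤ ∣ p ∣ + ∣ q ∣
∣p∪q∣≤∣p∣+∣q∣ []            []            = z≤n
∣p∪q∣≤∣p∣+∣q∣ (inside  ∷ p) (inside  ∷ q) =
  s≤s (≤-trans (∣p∪q∣≤∣p∣+∣q∣ p q) (≤-trans (n≤1+n _) (≤-reflexive (sym (+-suc _ _)))))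
∣p∪q∣≤∣p∣+∣q∣ (inside  ∷ p) (outside ∷ q) = s≤s (∣p∪q∣≤∣p∣+∣q∣ p q)
∣p∪q∣≤∣p∣+∣q∣ (outside ∷ p) (inside  ∷ q) = ≤-trans (s≤s (∣p∪q∣≤∣p∣+∣q∣ p q)) (≤-reflexive (sym (+-suc _ _)))
∣p∪q∣≤∣p∣+∣q∣ (outside ∷ p) (outside ∷ q) = ∣p∪q∣≤∣p∣+∣q∣ p q

another : ∀ {n} → 2 ≤ n → (x : Fin n) → ∃[ y ] (y ≢ x)
another (s≤s (s≤s _)) zero    = suc zero , λ ()
another (s≤s (s≤s _)) (suc x) = zero , λ ()

Unique-∷ʳ : ∀ {a} {A : Set a} {xs : List A} {x} → Unique xs → x ∉ₗ xs → Unique (xs ∷ʳ x)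
Unique-∷ʳ unique x∉xs = Unique.++⁺ unique ([] ∷ []) λ { (x∈xs , here refl) → x∉xs x∈xs }

module _ {n : ℕ} where

  x∈tabulate⁺ : ∀ {f : Fin n → Bool} {x} → T (f x) → x ∈ tabulate f
  x∈tabulate⁺ {f} {x} t = lookup⇒[]= x (tabulate f) (trans (lookup∘tabulate f x) (Equivalence.to T-≡ t))

  x∈tabulate⁻ : ∀ {f : Fin n → Bool} {x} → x ∈ tabulate f → T (f x)
  x∈tabulate⁻ {f} {x} x∈ = Equivalence.from T-≡ (trans (sym (lookup∘tabulate f x)) ([]=⇒lookup x∈))

  x∈p─q⁻ : ∀ {p q : Subset n} {x} → x ∈ p ─ q → x ∈ p × x ∉ q
  x∈p─q⁻ {p} {q} x∈ = p─q⊆p p q x∈ , x∈p─q⇒x∉q p q x∈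

  x∈p∧x∉p─q⇒x∈q : ∀ {p q : Subset n} {x} → x ∈ p → x ∉ p ─ q → x ∈ q
  x∈p∧x∉p─q⇒x∈q {q = q} {x} x∈p x∉ with x ∈? q
  ... | yes x∈q = x∈q
  ... | no  x∉q = contradiction (x∈p∧x∉q⇒x∈p─q x∈p x∉q) x∉

  x∈p─⁅y⁆∪q⁻ : ∀ {p q : Subset n} {x y} → x ∈ p ─ (⁅ y ⁆ ∪ q) → x ∈ p × x ≢ y × x ∉ q
  x∈p─⁅y⁆∪q⁻ {p} {q} {x} {y} x∈ =
    let x∈p , x∉ = x∈p─q⁻ {q = ⁅ y ⁆ ∪ q} x∈
    in x∈p , (λ { refl → x∉ (x∈p∪q⁺ (inj₁ (x∈⁅x⁆ x))) }) , (λ x∈q → x∉ (x∈p∪q⁺ (inj₂ x∈q)))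

  x∈p─⁅y⁆∪q⁺ : ∀ {p q : Subset n} {x y} → x ∈ p → x ≢ y → x ∉ q → x ∈ p ─ (⁅ y ⁆ ∪ q)
  x∈p─⁅y⁆∪q⁺ {q = q} {y = y} x∈p x≢y x∉q =
    x∈p∧x∉q⇒x∈p─q x∈p ([ x≢y ∘ x∈⁅y⁆⇒x≡y y , x∉q ]′ ∘ x∈p∪q⁻ ⁅ y ⁆ q)

  x∈p∧x∉p─⁅y⁆∪q⇒x≡y⊎x∈q : ∀ {p q : Subset n} {x y} → x ∈ p → x ∉ p ─ (⁅ y ⁆ ∪ q) → x ≡ y ⊎ x ∈ q
  x∈p∧x∉p─⁅y⁆∪q⇒x≡y⊎x∈q {q = q} {y = y} x∈p x∉ =
    Sum.map₁ (x∈⁅y⁆⇒x≡y y) (x∈p∪q⁻ ⁅ y ⁆ q (x∈p∧x∉p─q⇒x∈q x∈p x∉))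

  p⊆q∧x∉p⇒∣p∣<∣q∣ : ∀ {p q : Subset n} {x} → p ⊆ q → x ∈ q → x ∉ p → ∣ p ∣ < ∣ q ∣
  p⊆q∧x∉p⇒∣p∣<∣q∣ p⊆q x∈q x∉p = p⊂q⇒∣p∣<∣q∣ (p⊆q , _ , x∈q , x∉p)

  p⊆q∧∣q∣≤∣p∣⇒q⊆p : ∀ {p q : Subset n} → p ⊆ q → ∣ q ∣ ≤ ∣ p ∣ → q ⊆ p
  p⊆q∧∣q∣≤∣p∣⇒q⊆p {p} p⊆q ∣q∣≤∣p∣ {x} x∈q with x ∈? p
  ... | yes x∈p = x∈p
  ... | no  x∉p = contradiction ∣q∣≤∣p∣ (<⇒≱ (p⊆q∧x∉p⇒∣p∣<∣q∣ p⊆q x∈q x∉p))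

  p⊆q∪⁅x⁆⇒∣p∣≤1+∣q∣ : ∀ {p q : Subset n} x → p ⊆ q ∪ ⁅ x ⁆ → ∣ p ∣ ≤ suc ∣ q ∣
  p⊆q∪⁅x⁆⇒∣p∣≤1+∣q∣ {p} {q} x p⊆ = begin
    ∣ p ∣             ≤⟨ p⊆q⇒∣p∣≤∣q∣ p⊆ ⟩
    ∣ q ∪ ⁅ x ⁆ ∣     ≤⟨ ∣p∪q∣≤∣p∣+∣q∣ q ⁅ x ⁆ ⟩
    ∣ q ∣ + ∣ ⁅ x ⁆ ∣ ≡⟨ cong (∣ q ∣ +_) (∣⁅x⁆∣≡1 x) ⟩
    ∣ q ∣ + 1         ≡⟨ +-comm ∣ q ∣ 1 ⟩
    suc ∣ q ∣         ∎
    where open ≤-Reasoning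

  Nonempty⇒0<∣p∣ : ∀ {p : Subset n} → Nonempty p → 0 < ∣ p ∣
  Nonempty⇒0<∣p∣ {p} (x , x∈p) = subst (_< ∣ p ∣) (∣⊥∣≡0 n) (p⊆q∧x∉p⇒∣p∣<∣q∣ {p = ∅} (⊥-elim ∘ ∉⊥) x∈p ∉⊥)

  0<∣p∣⇒Nonempty : ∀ {p : Subset n} → 0 < ∣ p ∣ → Nonempty p
  0<∣p∣⇒Nonempty {p} 0<∣p∣ with nonempty? p
  ... | yes p≢∅ = p≢∅
  ... | no  p≡∅ = contradiction (subst (0 <_) (trans (cong ∣_∣ (Empty-unique p≡∅)) (∣⊥∣≡0 n)) 0<∣p∣) (<-irrefl refl)

  ∣p∣≤1⇒x≡y : ∀ {p : Subset n} {x y} → ∣ p ∣ ≤ 1 → x ∈ p → y ∈ p → x ≡ y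
  ∣p∣≤1⇒x≡y {p} {x} {y} ∣p∣≤1 x∈p y∈p with x ≟ᶠ y
  ... | yes x≡y = x≡y
  ... | no  x≢y = contradiction ∣p∣≤1 (<⇒≱ (subst (_< ∣ p ∣) (∣⁅x⁆∣≡1 x) ∣⁅x⁆∣<∣p∣))
    where
    ∣⁅x⁆∣<∣p∣ : ∣ ⁅ x ⁆ ∣ < ∣ p ∣
    ∣⁅x⁆∣<∣p∣ = p⊆q∧x∉p⇒∣p∣<∣q∣ (λ z∈ → subst (_∈ p) (sym (x∈⁅y⁆⇒x≡y x z∈)) x∈p) y∈p (x≢y ∘ sym ∘ x∈⁅y⁆⇒x≡y x)

  Unique⇒length≤n : ∀ {xs : List (Fin n)} → Unique xs → length xs ≤ n
  Unique⇒length≤n {xs} unique = ≤-trans (length≤∣elems∣ unique) (∣p∣≤n (⋃ (map ⁅_⁆ xs)))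
    where
    ∈elems⁻ : ∀ {y} ys → y ∈ ⋃ (map ⁅_⁆ ys) → y ∈ₗ ys
    ∈elems⁻ []       y∈ = ⊥-elim (∉⊥ y∈)
    ∈elems⁻ (x ∷ ys) y∈ = [ here ∘ x∈⁅y⁆⇒x≡y x , there ∘ ∈elems⁻ ys ]′ (x∈p∪q⁻ ⁅ x ⁆ _ y∈)
    length≤∣elems∣ : ∀ {ys} → Unique ys → length ys ≤ ∣ ⋃ (map ⁅_⁆ ys) ∣
    length≤∣elems∣ {[]}     []         = z≤n
    length≤∣elems∣ {x ∷ ys} (x∉ys ∷ u) =
      ≤-trans (s≤s (length≤∣elems∣ u))
              (p⊆q∧x∉p⇒∣p∣<∣q∣ (x∈p∪q⁺ ∘ inj₂) (x∈p∪q⁺ (inj₁ (x∈⁅x⁆ x)))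
                               (λ x∈ → All.lookup x∉ys (∈elems⁻ ys x∈) refl))

takeThrough : ∀ {n} → Fin n → List (Fin n) → List (Fin n)
takeThrough c []       = []
takeThrough c (a ∷ xs) with a ≟ᶠ c
... | yes _ = a ∷ []
... | no  _ = a ∷ takeThrough c xs

module _ {n : ℕ} {c : Fin n} where

  All-takeThrough : ∀ {P : Fin n → Set} {xs} → All P xs → All P (takeThrough c xs)
  All-takeThrough {xs = []}     []         = []
  All-takeThrough {xs = a ∷ xs} (pa ∷ pxs) with a ≟ᶠ c
  ... | yes _ = pa ∷ []
  ... | no  _ = pa ∷ All-takeThrough pxs

  Unique-takeThrough : ∀ {xs} → Unique xs → Unique (takeThrough c xs)
  Unique-takeThrough {[]}     []         = []
  Unique-takeThrough {a ∷ xs} (a∉xs ∷ u) with a ≟ᶠ c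
  ... | yes _ = [] ∷ []
  ... | no  _ = All-takeThrough a∉xs ∷ Unique-takeThrough u

  takeThrough-nonempty : ∀ {xs} → c ∈ₗ xs → 1 ≤ length (takeThrough c xs)
  takeThrough-nonempty {a ∷ xs} _ with a ≟ᶠ c
  ... | yes _ = s≤s z≤n
  ... | no  _ = s≤s z≤n

  Linked-takeThrough : ∀ {R : Fin n → Fin n → Set} {x h xs} → Linked R (x ∷ xs) → c ∈ₗ xs → R c h →
                       Linked R ((x ∷ takeThrough c xs) ∷ʳ h)
  Linked-takeThrough {xs = a ∷ xs} (xa ∷ link) c∈ ch with a ≟ᶠ c | c∈
  ... | yes refl | _          = xa ∷ ch ∷ [-]
  ... | no  a≢c  | here c≡a   = contradiction (sym c≡a) a≢c
  ... | no  _    | there c∈xs = xa ∷ Linked-takeThrough link c∈xs ch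

module _ {n : ℕ} (G : SimpleGraph n) where

  -- Leaves and the reduction step

  Adj-sym : ∀ {u v} → Adj G u v → Adj G v u
  Adj-sym {u} {v} = subst T (adj-sym G u v)

  Adj-irrefl : ∀ {v} → ¬ Adj G v v
  Adj-irrefl {v} = subst T (irrefl G v)

  Adj⇒≢ : ∀ {u v} → Adj G u v → u ≢ v
  Adj⇒≢ uv refl = Adj-irrefl uv

  Adj? : ∀ u v → Dec (Adj G u v)
  Adj? u v = T? (adj G u v)

  AtMostOneNbrIn : Subset n → Fin n → Set
  AtMostOneNbrIn S x = ∀ {y z} → y ∈ S → z ∈ S → Adj G x y → Adj G x z → y ≡ z

  NoIsolated : Subset n → Set
  NoIsolated F = ∀ {x} → x ∈ F → ∃[ y ] (y ∈ F × Adj G x y)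

  connected⇒NoIsolated : Connected G → 2 ≤ n → NoIsolated Full
  connected⇒NoIsolated connected 2≤n {x} _ with another 2≤n x
  ... | y , y≢x with connected x y
  ...   | here      = contradiction refl y≢x
  ...   | step xz _ = _ , ∈⊤ , xz

  ∈Nbhd⁺ : ∀ {v x} → Adj G v x → x ∈ Nbhd G v
  ∈Nbhd⁺ = x∈tabulate⁺

  ∈Nbhd⁻ : ∀ {v x} → x ∈ Nbhd G v → Adj G v x
  ∈Nbhd⁻ = x∈tabulate⁻

  ∈Leaves⁺ : ∀ {F x} → x ∈ F → degIn G F x ≡ 1 → x ∈ Leaves G F
  ∈Leaves⁺ {F} {x} x∈F deg≡1 =
    x∈tabulate⁺ (Equivalence.from T-∧ (Equivalence.from T-≡ ([]=⇒lookup x∈F) , ≡⇒≡ᵇ _ 1 deg≡1))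

  ∈Leaves⁻ : ∀ {F x} → x ∈ Leaves G F → x ∈ F × degIn G F x ≡ 1
  ∈Leaves⁻ {F} {x} x∈L =
    let t , deg≡ᵇ1 = Equivalence.to T-∧ (x∈tabulate⁻ x∈L)
    in lookup⇒[]= x F (Equivalence.to T-≡ t) , ≡ᵇ⇒≡ _ 1 deg≡ᵇ1

  ∈Leaves⇒AtMostOneNbrIn : ∀ {F x} → x ∈ Leaves G F → AtMostOneNbrIn F x
  ∈Leaves⇒AtMostOneNbrIn {F} x∈L y∈F z∈F xy xz =
    ∣p∣≤1⇒x≡y (≤-reflexive (proj₂ (∈Leaves⁻ {F} x∈L))) (x∈p∩q⁺ (y∈F , ∈Nbhd⁺ xy)) (x∈p∩q⁺ (z∈F , ∈Nbhd⁺ xz))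

  nonleaf⇒another-nbr : ∀ {F x y} → x ∈ F → y ∈ F → Adj G x y → x ∉ Leaves G F →
                        ∃[ z ] (z ∈ F × Adj G x z × z ≢ y)
  nonleaf⇒another-nbr {F} {x} {y} x∈F y∈F xy x∉L
    with any? (λ z → z ∈? F ×-dec Adj? x z ×-dec ¬? (z ≟ᶠ y))
  ... | yes found = found
  ... | no  ∄z    = contradiction (∈Leaves⁺ {F} x∈F (≤-antisym deg≤1 1≤deg)) x∉L
    where
    nbrs⊆⁅y⁆ : F ∩ Nbhd G x ⊆ ⁅ y ⁆
    nbrs⊆⁅y⁆ {z} z∈ with z ≟ᶠ y | x∈p∩q⁻ F (Nbhd G x) z∈
    ... | yes refl | _          = x∈⁅x⁆ y
    ... | no  z≢y  | z∈F , z∈N = contradiction (z , z∈F , ∈Nbhd⁻ z∈N , z≢y) ∄z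
    deg≤1 : degIn G F x ≤ 1
    deg≤1 = ≤-trans (p⊆q⇒∣p∣≤∣q∣ nbrs⊆⁅y⁆) (≤-reflexive (∣⁅x⁆∣≡1 y))
    1≤deg : 1 ≤ degIn G F x
    1≤deg = Nonempty⇒0<∣p∣ (y , x∈p∩q⁺ (y∈F , ∈Nbhd⁺ xy))

  ∈Leaves-restrict : ∀ {F F′ x} → F′ ⊆ F → x ∈ F′ → (∀ {y} → y ∈ F → Adj G x y → y ∈ F′) →
                     x ∈ Leaves G F′ → x ∈ Leaves G F
  ∈Leaves-restrict {F} {F′} {x} F′⊆F x∈F′ nbrs-stay x∈L′ =
    ∈Leaves⁺ {F} (F′⊆F x∈F′) (trans (cong ∣_∣ (sym same-nbrs)) (proj₂ (∈Leaves⁻ {F′} x∈L′)))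
    where
    same-nbrs : F′ ∩ Nbhd G x ≡ F ∩ Nbhd G x
    same-nbrs = ⊆-antisym
      (λ y∈ → let y∈F′ , y∈N = x∈p∩q⁻ F′ _ y∈ in x∈p∩q⁺ (F′⊆F y∈F′ , y∈N))
      (λ y∈ → let y∈F , y∈N = x∈p∩q⁻ F _ y∈ in x∈p∩q⁺ (nbrs-stay y∈F (∈Nbhd⁻ y∈N) , y∈N))

  leafNbrs : Subset n → Fin n → Subset n
  leafNbrs F v = Nbhd G v ∩ Leaves G F

  ∈leafNbrs⁻ : ∀ {F v x} → x ∈ leafNbrs F v → Adj G v x × x ∈ Leaves G F
  ∈leafNbrs⁻ {F} {v} x∈ = let x∈N , x∈L = x∈p∩q⁻ (Nbhd G v) (Leaves G F) x∈ in ∈Nbhd⁻ x∈N , x∈L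

  ∈leafNbrs⁺ : ∀ {F v x} → Adj G v x → x ∈ Leaves G F → x ∈ leafNbrs F v
  ∈leafNbrs⁺ vx x∈L = x∈p∩q⁺ (∈Nbhd⁺ vx , x∈L)

  leafNbrs-⊆ : ∀ {F v} → leafNbrs F v ⊆ F
  leafNbrs-⊆ {F} x∈ = proj₁ (∈Leaves⁻ {F} (proj₂ (∈leafNbrs⁻ {F} x∈)))

  leafNbr-only-nbr : ∀ {F v x y} → x ∈ leafNbrs F v → v ∈ F → y ∈ F → Adj G x y → y ≡ v
  leafNbr-only-nbr {F} x∈ v∈F y∈F xy =
    let vx , x∈L = ∈leafNbrs⁻ {F} x∈ in ∈Leaves⇒AtMostOneNbrIn x∈L y∈F v∈F xy (Adj-sym vx)

  ∣leafNbrs∣-mono : ∀ {F F′ u} → (∀ {x} → Adj G u x → x ∈ Leaves G F′ → x ∈ Leaves G F) →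
                    ∣ leafNbrs F′ u ∣ ≤ ∣ leafNbrs F u ∣
  ∣leafNbrs∣-mono {F} {F′} {u} old = p⊆q⇒∣p∣≤∣q∣ {p = leafNbrs F′ u} λ x∈ →
    let ux , x∈L′ = ∈leafNbrs⁻ {F′} x∈ in ∈leafNbrs⁺ {F} ux (old ux x∈L′)

  ∣leafNbrs∣≤1+ : ∀ {F F′ u} q → (∀ {x} → Adj G u x → x ∈ Leaves G F′ → x ∈ Leaves G F ⊎ x ≡ q) →
                  ∣ leafNbrs F′ u ∣ ≤ suc ∣ leafNbrs F u ∣
  ∣leafNbrs∣≤1+ {F} {F′} {u} q old-or-q = p⊆q∪⁅x⁆⇒∣p∣≤1+∣q∣ {p = leafNbrs F′ u} q λ x∈ →
    let ux , x∈L′ = ∈leafNbrs⁻ {F′} x∈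
    in x∈p∪q⁺ (Sum.map (∈leafNbrs⁺ {F} ux) (λ { refl → x∈⁅x⁆ q }) (old-or-q ux x∈L′))

  ∣leafNbrs∣≤1-of-leaf : ∀ {F F′ w} → F′ ⊆ F → w ∈ Leaves G F → ∣ leafNbrs F′ w ∣ ≤ 1
  ∣leafNbrs∣≤1-of-leaf {F} {F′} {w} F′⊆F w∈L =
    ≤-trans (p⊆q⇒∣p∣≤∣q∣ leafNbrs⊆nbrs) (≤-reflexive (proj₂ (∈Leaves⁻ {F} w∈L)))
    where
    leafNbrs⊆nbrs : leafNbrs F′ w ⊆ F ∩ Nbhd G w
    leafNbrs⊆nbrs x∈ = x∈p∩q⁺ (F′⊆F (leafNbrs-⊆ {F′} x∈) , ∈Nbhd⁺ (proj₁ (∈leafNbrs⁻ {F′} x∈)))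

  ∈stepF⁻ : ∀ {F v x} → x ∈ stepF G F v → x ∈ F × x ≢ v × x ∉ leafNbrs F v
  ∈stepF⁻ {F} {v} = x∈p─⁅y⁆∪q⁻ {p = F} {q = leafNbrs F v}

  ∈stepF⁺ : ∀ {F v x} → x ∈ F → x ≢ v → x ∉ leafNbrs F v → x ∈ stepF G F v
  ∈stepF⁺ = x∈p─⁅y⁆∪q⁺

  ∉stepF⁻ : ∀ {F v x} → x ∈ F → x ∉ stepF G F v → x ≡ v ⊎ x ∈ leafNbrs F v
  ∉stepF⁻ {F} {v} = x∈p∧x∉p─⁅y⁆∪q⇒x≡y⊎x∈q {p = F} {q = leafNbrs F v}

  stepF-⊆ : ∀ {F v} → stepF G F v ⊆ F
  stepF-⊆ {F} = p─q⊆p F _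

  stepF-keeps-nbrs : ∀ {F p x y} → p ∈ F → x ∈ stepF G F p → ¬ Adj G p x → y ∈ F → Adj G x y →
                     y ∈ stepF G F p
  stepF-keeps-nbrs {F} {p} {x} {y} p∈F x∈F₁ ¬px y∈F xy with y ∈? stepF G F p
  ... | yes y∈F₁ = y∈F₁
  ... | no  y∉F₁ with ∉stepF⁻ {F} y∈F y∉F₁ | ∈stepF⁻ {F} x∈F₁
  ...   | inj₁ refl | _             = contradiction (Adj-sym xy) ¬px
  ...   | inj₂ y∈Lp | x∈F , x≢p , _ = contradiction (leafNbr-only-nbr y∈Lp p∈F x∈F (Adj-sym xy)) x≢p

  ∈Leaves-stepF : ∀ {F p x} → p ∈ F → x ∈ Leaves G (stepF G F p) → ¬ Adj G p x → x ∈ Leaves G F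
  ∈Leaves-stepF {F} {p} p∈F x∈L₁ ¬px =
    let x∈F₁ = proj₁ (∈Leaves⁻ {stepF G F p} x∈L₁)
    in ∈Leaves-restrict (stepF-⊆ {F}) x∈F₁ (stepF-keeps-nbrs p∈F x∈F₁ ¬px) x∈L₁

  NoIsolated-stepF : ∀ {F v} → NoIsolated F → v ∈ F → NoIsolated (stepF G F v)
  NoIsolated-stepF {F} {v} noIso v∈F {x} x∈F₁ with ∈stepF⁻ {F} x∈F₁
  ... | x∈F , x≢v , x∉Lv with noIso x∈F
  ... | y , y∈F , xy with y ∈? stepF G F v
  ...   | yes y∈F₁ = y , y∈F₁ , xy
  ...   | no  y∉F₁ with ∉stepF⁻ {F} y∈F y∉F₁
  ...     | inj₂ y∈Lv = contradiction (leafNbr-only-nbr y∈Lv v∈F x∈F (Adj-sym xy)) x≢v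
  ...     | inj₁ refl =
    let z , z∈F , xz , z≢v = nonleaf⇒another-nbr x∈F v∈F xy (x∉Lv ∘ ∈leafNbrs⁺ {F} (Adj-sym xy))
        z∉Lv = λ z∈Lv → x≢v (leafNbr-only-nbr z∈Lv v∈F x∈F (Adj-sym xz))
    in z , ∈stepF⁺ z∈F z≢v z∉Lv , xz

  reduce-∷ʳ : ∀ F vs v → reduce G F (vs ∷ʳ v) ≡ stepF G (reduce G F vs) v
  reduce-∷ʳ F []       v = refl
  reduce-∷ʳ F (a ∷ vs) v = reduce-∷ʳ (stepF G F a) vs v

  reduce-⊆ : ∀ F vs → reduce G F vs ⊆ F
  reduce-⊆ F []       = id
  reduce-⊆ F (a ∷ vs) = stepF-⊆ {F} ∘ reduce-⊆ (stepF G F a) vs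

  ∈ₗ⇒∉reduce : ∀ F {vs v} → v ∈ₗ vs → v ∉ reduce G F vs
  ∈ₗ⇒∉reduce F {a ∷ vs} (here refl)  v∈ = proj₁ (proj₂ (∈stepF⁻ {F} (reduce-⊆ (stepF G F a) vs v∈))) refl
  ∈ₗ⇒∉reduce F {a ∷ vs} (there v∈vs)    = ∈ₗ⇒∉reduce (stepF G F a) v∈vs

  AdmissibleFrom-∷ʳ : ∀ {b} F vs {v} → AdmissibleFrom G b F vs → ∣ leafNbrs (reduce G F vs) v ∣ ≡ b →
                      AdmissibleFrom G b F (vs ∷ʳ v)
  AdmissibleFrom-∷ʳ F []       _          ∣Lv∣≡b = ∣Lv∣≡b , _
  AdmissibleFrom-∷ʳ F (a ∷ vs) (≡b , adm) ∣Lv∣≡b = ≡b , AdmissibleFrom-∷ʳ (stepF G F a) vs adm ∣Lv∣≡b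

  -- Forests

  TwoNbrsIn : Subset n → Fin n → Set
  TwoNbrsIn S x = ∃[ y ] (y ∈ S × Adj G x y × ∃[ z ] (z ∈ S × Adj G x z × y ≢ z))

  TwoNbrsIn? : ∀ S x → Dec (TwoNbrsIn S x)
  TwoNbrsIn? S x = any? λ y → y ∈? S ×-dec Adj? x y ×-dec any? λ z → z ∈? S ×-dec Adj? x z ×-dec ¬? (y ≟ᶠ z)

  ¬TwoNbrsIn⇒AtMostOneNbrIn : ∀ {S x} → ¬ TwoNbrsIn S x → AtMostOneNbrIn S x
  ¬TwoNbrsIn⇒AtMostOneNbrIn ¬two {y} {z} y∈S z∈S xy xz with y ≟ᶠ z
  ... | yes y≡z = y≡z
  ... | no  y≢z = contradiction (y , y∈S , xy , z , z∈S , xz , y≢z) ¬two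

  module _ (acyclic : Acyclic G) where
    open import Data.List.Membership.DecPropositional (_≟ᶠ_ {n}) using () renaming (_∈?_ to _∈ₗ?_)

    nbr-on-path⇒next : ∀ {h y rest} → Unique (h ∷ rest) → Linked (Adj G) (h ∷ rest) → Adj G h y →
                       y ∈ₗ h ∷ rest → ∃[ rest′ ] (rest ≡ y ∷ rest′)
    nbr-on-path⇒next _ _ hy (here refl)         = contradiction hy Adj-irrefl
    nbr-on-path⇒next _ _ _  (there (here refl)) = _ , refl
    nbr-on-path⇒next {h} {y} {x ∷ rest′} ((h≢x ∷ h∉rest′) ∷ x∉rest′ ∷ u) (hx ∷ link) hy (there (there y∈rest′)) =
      contradiction
        ( s≤s (takeThrough-nonempty y∈rest′)
        , (h≢x ∷ All-takeThrough h∉rest′) ∷ All-takeThrough x∉rest′ ∷ Unique-takeThrough u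
        , hx ∷ Linked-takeThrough link y∈rest′ (Adj-sym hy))
        (acyclic h (x ∷ takeThrough y rest′))

    path-extends : ∀ {S h rest} → Unique (h ∷ rest) → Linked (Adj G) (h ∷ rest) → TwoNbrsIn S h →
                   ∃[ y ] (y ∈ S × Adj G h y × y ∉ₗ h ∷ rest)
    path-extends {S} {h} {rest} u link (y , y∈S , hy , z , z∈S , hz , y≢z)
      with y ∈ₗ? (h ∷ rest) | z ∈ₗ? (h ∷ rest)
    ... | no  y∉ | _      = y , y∈S , hy , y∉
    ... | yes _  | no z∉  = z , z∈S , hz , z∉
    ... | yes y∈ | yes z∈ =
      let _ , rest≡y∷ = nbr-on-path⇒next u link hy y∈
          _ , rest≡z∷ = nbr-on-path⇒next u link hz z∈
      in contradiction (proj₁ (∷-injective (trans (sym rest≡y∷) rest≡z∷))) y≢z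

    long-path : ∀ {S x₀} → (∀ {x} → x ∈ S → TwoNbrsIn S x) → x₀ ∈ S → ∀ k →
                ∃[ h ] ∃[ rest ] (h ∈ S × Unique (h ∷ rest) × Linked (Adj G) (h ∷ rest) × length rest ≡ k)
    long-path {x₀ = x₀} two x₀∈S zero = x₀ , [] , x₀∈S , [] ∷ [] , [-] , refl
    long-path two x₀∈S (suc k) with long-path two x₀∈S k
    ... | h , rest , h∈S , u , link , refl =
      let y , y∈S , hy , y∉ = path-extends u link (two h∈S)
      in y , h ∷ rest , y∈S , ¬Any⇒All¬ _ y∉ ∷ u , Adj-sym hy ∷ link , refl

    low-degree-vertex : ∀ {S} → Nonempty S → ∃[ x ] (x ∈ S × AtMostOneNbrIn S x)
    low-degree-vertex {S} (x₀ , x₀∈S) with any? (λ x → x ∈? S ×-dec ¬? (TwoNbrsIn? S x))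
    ... | yes (x , x∈S , ¬two) = x , x∈S , ¬TwoNbrsIn⇒AtMostOneNbrIn ¬two
    ... | no ∄x =
      let _ , rest , _ , u , _ , length≡n = long-path all-two x₀∈S n
      in contradiction (Unique⇒length≤n u) (subst (λ k → ¬ suc k ≤ n) (sym length≡n) (<-irrefl refl))
      where
      all-two : ∀ {x} → x ∈ S → TwoNbrsIn S x
      all-two {x} x∈S with TwoNbrsIn? S x
      ... | yes two = two
      ... | no ¬two = contradiction (x , x∈S , ¬two) ∄x

    peelable-vertex : ∀ {F} → NoIsolated F → Nonempty F →
                      ∃[ p ] (p ∈ F × Nonempty (leafNbrs F p) × AtMostOneNbrIn (F ─ Leaves G F) p)
    peelable-vertex {F} noIso (x₀ , x₀∈F) with nonempty? (F ─ Leaves G F)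
    ... | no all-leaves =
      let y , y∈F , x₀y = noIso x₀∈F
          x₀∈L = x∈p∧x∉p─q⇒x∈q x₀∈F (λ x₀∈ → all-leaves (x₀ , x₀∈))
      in y , y∈F , (x₀ , ∈leafNbrs⁺ {F} (Adj-sym x₀y) x₀∈L) , λ y∈ _ _ _ → contradiction (_ , y∈) all-leaves
    ... | yes inner =
      let p , p∈inner , one = low-degree-vertex inner
          p∈F , p∉L = x∈p─q⁻ {q = Leaves G F} p∈inner
      in p , p∈F , leaf-nbr p∈F p∉L one , one
      where
      leaf-nbr : ∀ {p} → p ∈ F → p ∉ Leaves G F → AtMostOneNbrIn (F ─ Leaves G F) p → Nonempty (leafNbrs F p)
      leaf-nbr p∈F p∉L one with noIso p∈F
      ... | y , y∈F , py with nonleaf⇒another-nbr p∈F y∈F py p∉L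
      ... | z , z∈F , pz , z≢y with y ∈? Leaves G F | z ∈? Leaves G F
      ... | yes y∈L | _       = y , ∈leafNbrs⁺ {F} py y∈L
      ... | no _    | yes z∈L = z , ∈leafNbrs⁺ {F} pz z∈L
      ... | no y∉L  | no z∉L  =
        contradiction (one (x∈p∧x∉q⇒x∈p─q z∈F z∉L) (x∈p∧x∉q⇒x∈p─q y∈F y∉L) pz py) z≢y

  -- Staller's strategy

  Disjoint : Subset n → Subset n → Set
  Disjoint D S = ∀ {x} → x ∈ D → x ∉ S

  Disjoint-∪ˡ : ∀ {D X S} → Disjoint D S → Disjoint X S → Disjoint (D ∪ X) S
  Disjoint-∪ˡ {D} {X} D∩S X∩S x∈ = [ D∩S , X∩S ]′ (x∈p∪q⁻ D X x∈)

  Disjoint-∪⁅⁆ʳ : ∀ {D S y} → Disjoint D S → y ∉ D → Disjoint D (S ∪ ⁅ y ⁆)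
  Disjoint-∪⁅⁆ʳ {S = S} {y} D∩S y∉D x∈D x∈ =
    [ D∩S x∈D , (λ x∈⁅y⁆ → y∉D (subst (_∈ _) (x∈⁅y⁆⇒x≡y y x∈⁅y⁆) x∈D)) ]′ (x∈p∪q⁻ S ⁅ y ⁆ x∈)

  free-vertex : ∀ {D S} → ¬ AllClaimed G D S → ∃[ v ] Free G D S v
  free-vertex {D} {S} ¬all with all? (λ v → v ∈? D ⊎-dec v ∈? S)
  ... | yes all  = contradiction all ¬all
  ... | no ¬all′ =
    let v , v∉ = ¬∀⟶∃¬ n _ (λ v → v ∈? D ⊎-dec v ∈? S) ¬all′ in v , v∉ ∘ inj₁ , v∉ ∘ inj₂

  isolated⇒¬Dominating : ∀ {D S x} → x ∈ S → (∀ {w} → Adj G x w → w ∈ S) → Disjoint D S → ¬ Dominating G D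
  isolated⇒¬Dominating x∈S nbrs∈S D∩S dom =
    let u , u∈D , ux = dom _ (λ x∈D → D∩S x∈D x∈S) in D∩S u∈D (nbrs∈S (Adj-sym ux))

  -- The position reached when Staller has played along an admissible sequence that reduces the tree to F.
  record Residual (F D S : Subset n) : Set where
    field
      free     : ∀ {x} → x ∈ F → Free G D S x
      boundary : ∀ {x w} → x ∈ F → w ∉ F → Adj G x w → w ∈ S
      disjoint : Disjoint D S

  Residual-initial : Residual Full ∅ ∅
  Residual-initial = record
    { free = λ _ → ∉⊥ , ∉⊥ ; boundary = λ _ w∉ _ → contradiction ∈⊤ w∉ ; disjoint = λ _ → ∉⊥ }

  module _ {F D S : Subset n} (res : Residual F D S) where
    open Residual res

    centre∈F : ∀ {v} → v ∉ S → Nonempty (leafNbrs F v) → v ∈ F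
    centre∈F {v} v∉S (y , y∈Lv) with v ∈? F
    ... | yes v∈F = v∈F
    ... | no  v∉F = contradiction (boundary (leafNbrs-⊆ {F} y∈Lv) v∉F (Adj-sym (proj₁ (∈leafNbrs⁻ {F} y∈Lv)))) v∉S

    leafNbr-free : ∀ {v y} → y ∈ leafNbrs F v → Free G D (S ∪ ⁅ v ⁆) y
    leafNbr-free {v} {y} y∈Lv =
      let y∉D , y∉S = free (leafNbrs-⊆ {F} y∈Lv)
      in y∉D , [ y∉S , Adj⇒≢ (Adj-sym (proj₁ (∈leafNbrs⁻ {F} y∈Lv))) ∘ x∈⁅y⁆⇒x≡y v ]′ ∘ x∈p∪q⁻ S ⁅ v ⁆

    round-disjoint : ∀ {v X} → v ∈ F → Disjoint X (S ∪ ⁅ v ⁆) → Disjoint (D ∪ X) (S ∪ ⁅ v ⁆)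
    round-disjoint v∈F = Disjoint-∪ˡ (Disjoint-∪⁅⁆ʳ disjoint (proj₁ (free v∈F)))

    trapped-leaf : ∀ {v y X} → v ∈ F → Disjoint X (S ∪ ⁅ v ⁆) → y ∈ leafNbrs F v → y ∉ X →
                   let S′ = (S ∪ ⁅ v ⁆) ∪ ⁅ y ⁆ in
                   y ∈ S′ × (∀ {w} → Adj G y w → w ∈ S′) × Disjoint (D ∪ X) S′
    trapped-leaf {v} {y} {X} v∈F X∩S′ y∈Lv y∉X =
      x∈p∪q⁺ (inj₂ (x∈⁅x⁆ y)) , nbrs∈S′ ,
      Disjoint-∪⁅⁆ʳ (round-disjoint v∈F X∩S′) ([ proj₁ (leafNbr-free y∈Lv) , y∉X ]′ ∘ x∈p∪q⁻ D X)
      where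
      nbrs∈S′ : ∀ {w} → Adj G y w → w ∈ (S ∪ ⁅ v ⁆) ∪ ⁅ y ⁆
      nbrs∈S′ {w} yw with w ∈? F
      ... | yes w∈F with leafNbr-only-nbr y∈Lv v∈F w∈F yw
      ...   | refl = x∈p∪q⁺ (inj₁ (x∈p∪q⁺ (inj₂ (x∈⁅x⁆ w))))
      nbrs∈S′ {w} yw | no w∉F = x∈p∪q⁺ (inj₁ (x∈p∪q⁺ (inj₁ (boundary (leafNbrs-⊆ {F} y∈Lv) w∉F yw))))

    Residual-stepF : ∀ {v X} → v ∈ F → X ⊆ leafNbrs F v → Disjoint X (S ∪ ⁅ v ⁆) →
                     Residual (stepF G F v) (D ∪ X) (S ∪ ⁅ v ⁆)
    Residual-stepF {v} {X} v∈F X⊆Lv X∩S′ =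
      record { free = free′ ; boundary = boundary′ ; disjoint = round-disjoint v∈F X∩S′ }
      where
      free′ : ∀ {x} → x ∈ stepF G F v → Free G (D ∪ X) (S ∪ ⁅ v ⁆) x
      free′ x∈F₁ =
        let x∈F , x≢v , x∉Lv = ∈stepF⁻ {F} x∈F₁
            x∉D , x∉S = free x∈F
        in [ x∉D , x∉Lv ∘ X⊆Lv ]′ ∘ x∈p∪q⁻ D X , [ x∉S , x≢v ∘ x∈⁅y⁆⇒x≡y v ]′ ∘ x∈p∪q⁻ S ⁅ v ⁆
      boundary′ : ∀ {x w} → x ∈ stepF G F v → w ∉ stepF G F v → Adj G x w → w ∈ S ∪ ⁅ v ⁆
      boundary′ {x} {w} x∈F₁ w∉F₁ xw with ∈stepF⁻ {F} x∈F₁ | w ∈? F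
      ... | x∈F , _   , _ | no  w∉F = x∈p∪q⁺ (inj₁ (boundary x∈F w∉F xw))
      ... | x∈F , x≢v , _ | yes w∈F with ∉stepF⁻ {F} w∈F w∉F₁
      ...   | inj₁ refl = x∈p∪q⁺ (inj₂ (x∈⁅x⁆ w))
      ...   | inj₂ w∈Lv = contradiction (leafNbr-only-nbr w∈Lv v∈F x∈F (Adj-sym xw)) x≢v

  module _ (b : ℕ) where

    DomWinsS⇒Dominating-avoiding : ∀ {D S} → Disjoint D S → DomWinsS G b D S →
                                   ∃[ D′ ] (Disjoint D′ S × Dominating G D′)
    DomWinsD⇒Dominating-avoiding : ∀ {D S} → Disjoint D S → DomWinsD G b D S →
                                   ∃[ D′ ] (Disjoint D′ S × Dominating G D′)

    DomWinsS⇒Dominating-avoiding D∩S (endS _ (D′ , D′⊆D , dom)) = D′ , D∩S ∘ D′⊆D , dom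
    DomWinsS⇒Dominating-avoiding D∩S (moveS ¬all next) =
      let v , v∉D , v∉S = free-vertex ¬all
          D′ , D′∩S′ , dom = DomWinsD⇒Dominating-avoiding (Disjoint-∪⁅⁆ʳ D∩S v∉D) (next v (v∉D , v∉S))
      in D′ , (λ x∈D′ x∈S → D′∩S′ x∈D′ (x∈p∪q⁺ (inj₁ x∈S))) , dom

    DomWinsD⇒Dominating-avoiding D∩S (endD _ (D′ , D′⊆D , dom)) = D′ , D∩S ∘ D′⊆D , dom
    DomWinsD⇒Dominating-avoiding D∩S (moveD _ X _ X-free win) =
      DomWinsS⇒Dominating-avoiding (Disjoint-∪ˡ D∩S (λ x∈X → proj₂ (X-free _ x∈X))) win

    Staller-claims : ∀ {D S v} → DomWinsS G b D S → Free G D S v → DomWinsD G b D (S ∪ ⁅ v ⁆)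
    Staller-claims {v = v} (endS all _)   (v∉D , v∉S) = ⊥-elim ([ v∉D , v∉S ]′ (all v))
    Staller-claims {v = v} (moveS _ next) v-free      = next v v-free

    Dominator-must-claim-leafNbrs :
      ∀ {F D S v} → Residual F D S → v ∈ F → Nonempty (leafNbrs F v) → DomWinsS G b D S →
      ∃[ X ] (∣ X ∣ ≤ b × leafNbrs F v ⊆ X × Disjoint X (S ∪ ⁅ v ⁆) × DomWinsS G b (D ∪ X) (S ∪ ⁅ v ⁆))
    Dominator-must-claim-leafNbrs {F} {D} {S} {v} res v∈F (y , y∈Lv) win
      with Staller-claims win (Residual.free res v∈F)
    ... | endD all _ = ⊥-elim ([ proj₁ (leafNbr-free res y∈Lv) , proj₂ (leafNbr-free res y∈Lv) ]′ (all y))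
    ... | moveD _ X ∣X∣≤b X-free win′ with any? (λ y → y ∈? leafNbrs F v ×-dec ¬? (y ∈? X))
    ...   | no ∄y = X , ∣X∣≤b , Lv⊆X , X∩S′ , win′
      where
      X∩S′ : Disjoint X (S ∪ ⁅ v ⁆)
      X∩S′ x∈X = proj₂ (X-free _ x∈X)
      Lv⊆X : leafNbrs F v ⊆ X
      Lv⊆X {y} y∈Lv with y ∈? X
      ... | yes y∈X = y∈X
      ... | no  y∉X = contradiction (y , y∈Lv , y∉X) ∄y
    ...   | yes (y , y∈Lv , y∉X) =
      let y∈S′ , nbrs∈S′ , D∪X∩S′ = trapped-leaf res v∈F (λ x∈X → proj₂ (X-free _ x∈X)) y∈Lv y∉X
          _ , D′∩S′ , dom = DomWinsD⇒Dominating-avoiding D∪X∩S′ (Staller-claims win′ y-free)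
      in ⊥-elim (isolated⇒¬Dominating y∈S′ nbrs∈S′ D′∩S′ dom)
      where
      y-free : Free G (D ∪ X) (S ∪ ⁅ v ⁆) y
      y-free = let y∉D , y∉S′ = leafNbr-free res y∈Lv in [ y∉D , y∉X ]′ ∘ x∈p∪q⁻ D X , y∉S′

    problematic⇒¬DomWinsS : 1 ≤ b → ∀ {F D S} vs u → AdmissibleFrom G b F vs → Unique (vs ∷ʳ u) →
                             suc b ≤ ∣ leafNbrs (reduce G F vs) u ∣ → Residual F D S →
                             (∀ {w} → w ∈ S → w ∉ₗ vs ∷ʳ u) → ¬ DomWinsS G b D S
    problematic⇒¬DomWinsS _ [] u _ _ b<∣Lu∣ res S∌ win =
      let Lu≢∅ = 0<∣p∣⇒Nonempty (<-≤-trans (s≤s z≤n) b<∣Lu∣)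
          u∈F = centre∈F res (λ u∈S → S∌ u∈S (here refl)) Lu≢∅
          X , ∣X∣≤b , Lu⊆X , _ = Dominator-must-claim-leafNbrs res u∈F Lu≢∅ win
      in contradiction (≤-trans b<∣Lu∣ (≤-trans (p⊆q⇒∣p∣≤∣q∣ Lu⊆X) ∣X∣≤b)) (<-irrefl refl)
    problematic⇒¬DomWinsS 1≤b {S = S} (v ∷ vs) u (∣Lv∣≡b , adm) (v∉ ∷ unique) b<∣Lu∣ res S∌ win =
      let Lv≢∅ = 0<∣p∣⇒Nonempty (≤-trans 1≤b (≤-reflexive (sym ∣Lv∣≡b)))
          v∈F = centre∈F res (λ v∈S → S∌ v∈S (here refl)) Lv≢∅
          X , ∣X∣≤b , Lv⊆X , X∩S′ , win′ = Dominator-must-claim-leafNbrs res v∈F Lv≢∅ win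
          X⊆Lv = p⊆q∧∣q∣≤∣p∣⇒q⊆p Lv⊆X (≤-trans ∣X∣≤b (≤-reflexive (sym ∣Lv∣≡b)))
      in problematic⇒¬DomWinsS 1≤b vs u adm unique b<∣Lu∣ (Residual-stepF res v∈F X⊆Lv X∩S′) S′∌ win′
      where
      S′∌ : ∀ {w} → w ∈ S ∪ ⁅ v ⁆ → w ∉ₗ vs ∷ʳ u
      S′∌ w∈ w∈vs = [ (λ w∈S → S∌ w∈S (there w∈vs)) , (λ w∈⁅v⁆ → All.lookup v∉ w∈vs (sym (x∈⁅y⁆⇒x≡y v w∈⁅v⁆))) ]′
                      (x∈p∪q⁻ S ⁅ v ⁆ w∈)

    winning⇒Good : 1 ≤ b → DominatorWinsStallerStart G b → Good G b
    winning⇒Good 1≤b win vs u (unique , (_ , adm) , b<∣Lu∣) =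
      problematic⇒¬DomWinsS 1≤b vs u adm unique b<∣Lu∣ Residual-initial (λ w∈∅ → ⊥-elim (∉⊥ w∈∅)) win

    -- Dominator's strategy

    record StarPartition (F : Subset n) : Set where
      field
        block           : Fin n → Subset n
        ∈-block         : ∀ {v} → v ∈ F → v ∈ block v
        block-⊆         : ∀ {v} → v ∈ F → block v ⊆ F
        block-cong      : ∀ {u v} → v ∈ F → u ∈ block v → block u ≡ block v
        ∣block─v∣≤b     : ∀ {v} → v ∈ F → ∣ block v ─ ⁅ v ⁆ ∣ ≤ b
        block-dominates : ∀ {v} → v ∈ F → ∃[ d ] (d ∈ block v × Adj G d v)

    record Star (F : Subset n) : Set where
      field
        centre        : Fin n
        rays          : Subset n
        centre-∈      : centre ∈ F
        rays-⊆        : rays ⊆ F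
        rays-adj      : ∀ {w} → w ∈ rays → Adj G centre w
        rays-nonempty : Nonempty rays
        ∣rays∣≤b      : ∣ rays ∣ ≤ b

      vertices : Subset n
      vertices = ⁅ centre ⁆ ∪ rays

      ∣F─vertices∣<∣F∣ : ∣ F ─ vertices ∣ < ∣ F ∣
      ∣F─vertices∣<∣F∣ = p∩q≢∅⇒∣p─q∣<∣p∣ F vertices (centre , x∈p∩q⁺ (centre-∈ , x∈p∪q⁺ (inj₁ (x∈⁅x⁆ centre))))

      vertices-⊆ : vertices ⊆ F
      vertices-⊆ x∈ =
        [ (λ x∈⁅c⁆ → subst (_∈ F) (sym (x∈⁅y⁆⇒x≡y centre x∈⁅c⁆)) centre-∈) , rays-⊆ ]′ (x∈p∪q⁻ ⁅ centre ⁆ rays x∈)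

      ∣vertices─v∣≤b : ∀ {v} → v ∈ vertices → ∣ vertices ─ ⁅ v ⁆ ∣ ≤ b
      ∣vertices─v∣≤b {v} v∈ with x∈p∪q⁻ ⁅ centre ⁆ rays v∈
      ... | inj₁ v∈⁅c⁆ = ≤-trans (p⊆q⇒∣p∣≤∣q∣ ⊆rays) ∣rays∣≤b
        where
        ⊆rays : vertices ─ ⁅ v ⁆ ⊆ rays
        ⊆rays {x} x∈ with x∈p─q⁻ {q = ⁅ v ⁆} x∈
        ... | x∈s , x∉⁅v⁆ =
          [ (λ x∈⁅c⁆ → contradiction (x≡v x∈⁅c⁆) (x∉⁅y⁆⇒x≢y x∉⁅v⁆)) , id ]′ (x∈p∪q⁻ ⁅ centre ⁆ rays x∈s)
          where
          x≡v : x ∈ ⁅ centre ⁆ → x ≡ v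
          x≡v x∈⁅c⁆ = trans (x∈⁅y⁆⇒x≡y centre x∈⁅c⁆) (sym (x∈⁅y⁆⇒x≡y centre v∈⁅c⁆))
      ... | inj₂ v∈rays = ≤-trans (p⊆q∪⁅x⁆⇒∣p∣≤1+∣q∣ centre ⊆rays─v∪c) (≤-trans (x∈p⇒∣p-x∣<∣p∣ v∈rays) ∣rays∣≤b)
        where
        ⊆rays─v∪c : vertices ─ ⁅ v ⁆ ⊆ (rays ─ ⁅ v ⁆) ∪ ⁅ centre ⁆
        ⊆rays─v∪c {x} x∈ with x∈p─q⁻ {q = ⁅ v ⁆} x∈
        ... | x∈s , x∉⁅v⁆ =
          x∈p∪q⁺ ([ inj₂ , (λ x∈rays → inj₁ (x∈p∧x∉q⇒x∈p─q x∈rays x∉⁅v⁆)) ]′ (x∈p∪q⁻ ⁅ centre ⁆ rays x∈s))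

      vertices-dominate : ∀ {v} → v ∈ vertices → ∃[ d ] (d ∈ vertices × Adj G d v)
      vertices-dominate v∈ with x∈p∪q⁻ ⁅ centre ⁆ rays v∈
      ... | inj₁ v∈⁅c⁆ =
        let w , w∈rays = rays-nonempty
        in w , x∈p∪q⁺ (inj₂ w∈rays) , subst (Adj G w) (sym (x∈⁅y⁆⇒x≡y centre v∈⁅c⁆)) (Adj-sym (rays-adj w∈rays))
      ... | inj₂ v∈rays = centre , x∈p∪q⁺ (inj₁ (x∈⁅x⁆ centre)) , rays-adj v∈rays

    StarPartition-∅ : ∀ {F} → (∀ {v} → v ∉ F) → StarPartition F
    StarPartition-∅ F≡∅ = record
      { block = ⁅_⁆ ; ∈-block = ⊥-elim ∘ F≡∅ ; block-⊆ = ⊥-elim ∘ F≡∅ ; block-cong = λ v∈F → ⊥-elim (F≡∅ v∈F)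
      ; ∣block─v∣≤b = ⊥-elim ∘ F≡∅ ; block-dominates = ⊥-elim ∘ F≡∅ }

    StarPartition-extend : ∀ {F} (s : Star F) → StarPartition (F ─ Star.vertices s) → StarPartition F
    StarPartition-extend {F} s P = record
      { block = block ; ∈-block = ∈-block ; block-⊆ = block-⊆ ; block-cong = block-cong
      ; ∣block─v∣≤b = ∣block─v∣≤b ; block-dominates = block-dominates }
      where
      open Star s
      module P = StarPartition P

      block : Fin n → Subset n
      block v with v ∈? vertices
      ... | yes _ = vertices
      ... | no  _ = P.block v

      ∈-block : ∀ {v} → v ∈ F → v ∈ block v
      ∈-block {v} v∈F with v ∈? vertices
      ... | yes v∈s = v∈s
      ... | no  v∉s = P.∈-block (x∈p∧x∉q⇒x∈p─q v∈F v∉s)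

      block-⊆ : ∀ {v} → v ∈ F → block v ⊆ F
      block-⊆ {v} v∈F with v ∈? vertices
      ... | yes _   = vertices-⊆
      ... | no  v∉s = p─q⊆p F vertices ∘ P.block-⊆ (x∈p∧x∉q⇒x∈p─q v∈F v∉s)

      block-cong : ∀ {u v} → v ∈ F → u ∈ block v → block u ≡ block v
      block-cong {u} {v} v∈F u∈ with v ∈? vertices | u ∈? vertices
      ... | yes _   | yes _   = refl
      ... | yes _   | no  u∉s = contradiction u∈ u∉s
      ... | no  v∉s | yes u∈s =
        contradiction u∈s (x∈p─q⇒x∉q F vertices (P.block-⊆ (x∈p∧x∉q⇒x∈p─q v∈F v∉s) u∈))
      ... | no  v∉s | no  _   = P.block-cong (x∈p∧x∉q⇒x∈p─q v∈F v∉s) u∈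

      ∣block─v∣≤b : ∀ {v} → v ∈ F → ∣ block v ─ ⁅ v ⁆ ∣ ≤ b
      ∣block─v∣≤b {v} v∈F with v ∈? vertices
      ... | yes v∈s = ∣vertices─v∣≤b v∈s
      ... | no  v∉s = P.∣block─v∣≤b (x∈p∧x∉q⇒x∈p─q v∈F v∉s)

      block-dominates : ∀ {v} → v ∈ F → ∃[ d ] (d ∈ block v × Adj G d v)
      block-dominates {v} v∈F with v ∈? vertices
      ... | yes v∈s = vertices-dominate v∈s
      ... | no  v∉s = P.block-dominates (x∈p∧x∉q⇒x∈p─q v∈F v∉s)

    module _ (P : StarPartition Full) where
      open StarPartition P

      -- Invariant of the pairing strategy: each block is either untouched or Staller owns exactly one of its
      -- vertices and Dominator all the others.

      Answered : Subset n → Subset n → Set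
      Answered D S = ∀ {v u} → v ∈ S → u ∈ block v → u ≢ v → u ∈ D

      Untouched : Subset n → Subset n → Set
      Untouched D S = ∀ {v u} → Free G D S v → u ∈ block v → Free G D S u

      Answered⇒Dominating : ∀ {D S} → AllClaimed G D S → Answered D S → Dominating G D
      Answered⇒Dominating all ans v v∉D with all v
      ... | inj₁ v∈D = contradiction v∈D v∉D
      ... | inj₂ v∈S = let d , d∈ , dv = block-dominates ∈⊤ in d , ans v∈S d∈ (Adj⇒≢ dv) , dv

      module Answer {D S v} (ans : Answered D S) (unt : Untouched D S) (v-free : Free G D S v) where

        X : Subset n
        X = block v ─ ⁅ v ⁆

        X-free : ∀ {z} → z ∈ X → Free G D (S ∪ ⁅ v ⁆) z
        X-free z∈X =
          let z∈block , z∉⁅v⁆ = x∈p─q⁻ {q = ⁅ v ⁆} z∈X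
              z∉D , z∉S = unt v-free z∈block
          in z∉D , [ z∉S , z∉⁅v⁆ ]′ ∘ x∈p∪q⁻ S ⁅ v ⁆

        Answered-step : Answered (D ∪ X) (S ∪ ⁅ v ⁆)
        Answered-step {w} {u} w∈S′ u∈block u≢w with x∈p∪q⁻ S ⁅ v ⁆ w∈S′
        ... | inj₁ w∈S = x∈p∪q⁺ (inj₁ (ans w∈S u∈block u≢w))
        ... | inj₂ w∈⁅v⁆ with x∈⁅y⁆⇒x≡y v w∈⁅v⁆
        ...   | refl = x∈p∪q⁺ (inj₂ (x∈p∧x∉q⇒x∈p─q u∈block (u≢w ∘ x∈⁅y⁆⇒x≡y w)))

        Untouched-step : Untouched (D ∪ X) (S ∪ ⁅ v ⁆)
        Untouched-step {w} {u} (w∉D′ , w∉S′) u∈block =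
          [ proj₁ u-free , u∉block-v ∘ proj₁ ∘ x∈p─q⁻ {q = ⁅ v ⁆} ]′ ∘ x∈p∪q⁻ D X ,
          [ proj₂ u-free , (λ u∈⁅v⁆ → u∉block-v (subst (_∈ block v) (sym (x∈⁅y⁆⇒x≡y v u∈⁅v⁆)) (∈-block ∈⊤))) ]′
            ∘ x∈p∪q⁻ S ⁅ v ⁆
          where
          u-free : Free G D S u
          u-free = unt (w∉D′ ∘ x∈p∪q⁺ ∘ inj₁ , w∉S′ ∘ x∈p∪q⁺ ∘ inj₁) u∈block
          u∉block-v : u ∉ block v
          u∉block-v u∈block-v =
            let w∈block-v = subst (w ∈_) (trans (sym (block-cong ∈⊤ u∈block)) (block-cong ∈⊤ u∈block-v)) (∈-block ∈⊤)
            in w∉D′ (x∈p∪q⁺ (inj₂ (x∈p∧x∉q⇒x∈p─q w∈block-v (w∉S′ ∘ x∈p∪q⁺ ∘ inj₂))))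

        unclaimed-decreases : ∣ ∁ ((D ∪ X) ∪ (S ∪ ⁅ v ⁆)) ∣ < ∣ ∁ (D ∪ S) ∣
        unclaimed-decreases = p⊆q∧x∉p⇒∣p∣<∣q∣ ∁-mono (x∉p⇒x∈∁p v-unclaimed) (λ v∈ → x∈∁p⇒x∉p v∈ v-claimed)
          where
          v-unclaimed : v ∉ D ∪ S
          v-unclaimed = [ proj₁ v-free , proj₂ v-free ]′ ∘ x∈p∪q⁻ D S
          v-claimed : v ∈ (D ∪ X) ∪ (S ∪ ⁅ v ⁆)
          v-claimed = x∈p∪q⁺ (inj₂ (x∈p∪q⁺ (inj₂ (x∈⁅x⁆ v))))
          ∁-mono : ∁ ((D ∪ X) ∪ (S ∪ ⁅ v ⁆)) ⊆ ∁ (D ∪ S)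
          ∁-mono x∈ = x∉p⇒x∈∁p λ x∈D∪S → x∈∁p⇒x∉p x∈
            ([ x∈p∪q⁺ ∘ inj₁ ∘ x∈p∪q⁺ ∘ inj₁ , x∈p∪q⁺ ∘ inj₂ ∘ x∈p∪q⁺ ∘ inj₁ ]′ (x∈p∪q⁻ D S x∈D∪S))

      pairing-strategy-from : ∀ k {D S} → ∣ ∁ (D ∪ S) ∣ < k → Answered D S → Untouched D S → DomWinsS G b D S
      pairing-strategy-from (suc k) {D} {S} bound ans unt with all? (λ v → v ∈? D ⊎-dec v ∈? S)
      ... | yes all = endS all (D , id , Answered⇒Dominating all ans)
      ... | no ¬all = moveS ¬all answer
        where
        answer : ∀ v → Free G D S v → DomWinsD G b D (S ∪ ⁅ v ⁆)
        answer v v-free with all? (λ x → x ∈? D ⊎-dec x ∈? S ∪ ⁅ v ⁆)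
        ... | no ¬all′ =
          moveD ¬all′ X (∣block─v∣≤b ∈⊤) (λ _ → X-free)
                (pairing-strategy-from k (≤-trans unclaimed-decreases (≤-pred bound)) Answered-step Untouched-step)
          where open Answer ans unt v-free
        ... | yes all′ = endD all′ (D ∪ X , D∪X⊆D , Answered⇒Dominating all″ Answered-step)
          where
          open Answer ans unt v-free
          D∪X⊆D : D ∪ X ⊆ D
          D∪X⊆D x∈ = [ id , (λ x∈X → [ id , (λ x∈S′ → contradiction x∈S′ (proj₂ (X-free x∈X))) ]′ (all′ _)) ]′
                       (x∈p∪q⁻ D X x∈)
          all″ : AllClaimed G (D ∪ X) (S ∪ ⁅ v ⁆)
          all″ x = Sum.map₁ (x∈p∪q⁺ ∘ inj₁) (all′ x)

      pairing-strategy : DominatorWinsStallerStart G b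
      pairing-strategy = pairing-strategy-from _ ≤-refl (λ v∈∅ → ⊥-elim (∉⊥ v∈∅)) (λ v-free _ → ∉⊥ , ∉⊥)

    -- Star partitions of b-good trees

    leafNbrs-star : ∀ {F v} → v ∈ F → Nonempty (leafNbrs F v) → ∣ leafNbrs F v ∣ ≤ b → Star F
    leafNbrs-star {F} {v} v∈F Lv≢∅ ∣Lv∣≤b = record
      { centre = v ; rays = leafNbrs F v ; centre-∈ = v∈F
      ; rays-⊆ = leafNbrs-⊆ {F}
      ; rays-adj = λ x∈ → proj₁ (∈leafNbrs⁻ {F} x∈)
      ; rays-nonempty = Lv≢∅ ; ∣rays∣≤b = ∣Lv∣≤b }

    FewLeafNbrs : Subset n → Set
    FewLeafNbrs F = ∀ {u} → u ∈ F → ∣ leafNbrs F u ∣ < b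

    module Peel {F p} (noIso : NoIsolated F) (few : FewLeafNbrs F) (p∈F : p ∈ F)
                (Lp≢∅ : Nonempty (leafNbrs F p)) (one : AtMostOneNbrIn (F ─ Leaves G F) p) where

      F₁ : Subset n
      F₁ = stepF G F p

      star₁ : Star F
      star₁ = leafNbrs-star p∈F Lp≢∅ (<⇒≤ (few p∈F))

      Fresh : Fin n → Set
      Fresh x = x ∈ Leaves G F₁ × x ∉ Leaves G F

      fresh⇒Adj : ∀ {x} → Fresh x → Adj G p x
      fresh⇒Adj {x} (x∈L₁ , x∉L) with Adj? p x
      ... | yes px = px
      ... | no ¬px = contradiction (∈Leaves-stepF p∈F x∈L₁ ¬px) x∉L

      fresh-unique : ∀ {x y} → Fresh x → Fresh y → x ≡ y
      fresh-unique fx@(x∈L₁ , x∉L) fy@(y∈L₁ , y∉L) =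
        one (x∈p∧x∉q⇒x∈p─q (stepF-⊆ {F} (proj₁ (∈Leaves⁻ {F₁} x∈L₁))) x∉L)
            (x∈p∧x∉q⇒x∈p─q (stepF-⊆ {F} (proj₁ (∈Leaves⁻ {F₁} y∈L₁))) y∉L)
            (fresh⇒Adj fx) (fresh⇒Adj fy)

      no-fresh⇒few : (∀ {x} → ¬ Fresh x) → FewLeafNbrs F₁
      no-fresh⇒few ¬fresh u∈F₁ = ≤-<-trans (∣leafNbrs∣-mono {F} {F₁} (λ _ → old)) (few (stepF-⊆ {F} u∈F₁))
        where
        old : ∀ {x} → x ∈ Leaves G F₁ → x ∈ Leaves G F
        old {x} x∈L₁ with x ∈? Leaves G F
        ... | yes x∈L = x∈L
        ... | no  x∉L = contradiction (x∈L₁ , x∉L) ¬fresh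

      module FreshLeaf {q} (fresh-q : Fresh q) where

        q∈L₁ : q ∈ Leaves G F₁
        q∈L₁ = proj₁ fresh-q

        q-nbr : ∃[ r ] (r ∈ F₁ × Adj G q r)
        q-nbr = let r , r∈ = 0<∣p∣⇒Nonempty (≤-reflexive (sym (proj₂ (∈Leaves⁻ {F₁} q∈L₁))))
                    r∈F₁ , r∈N = x∈p∩q⁻ F₁ (Nbhd G q) r∈
                in r , r∈F₁ , ∈Nbhd⁻ r∈N

        r : Fin n
        r = proj₁ q-nbr

        r∈F₁ : r ∈ F₁
        r∈F₁ = proj₁ (proj₂ q-nbr)

        qr : Adj G q r
        qr = proj₂ (proj₂ q-nbr)

        old-or-q : ∀ {x} → x ∈ Leaves G F₁ → x ∈ Leaves G F ⊎ x ≡ q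
        old-or-q {x} x∈L₁ with x ∈? Leaves G F
        ... | yes x∈L = inj₁ x∈L
        ... | no  x∉L = inj₂ (fresh-unique (x∈L₁ , x∉L) fresh-q)

        nbr-of-q⇒≡r : ∀ {u} → u ∈ F₁ → Adj G q u → u ≡ r
        nbr-of-q⇒≡r u∈F₁ qu = ∈Leaves⇒AtMostOneNbrIn q∈L₁ u∈F₁ r∈F₁ qu qr

        few-if-room-at-r : suc ∣ leafNbrs F r ∣ < b → FewLeafNbrs F₁
        few-if-room-at-r room {u} u∈F₁ with u ≟ᶠ r
        ... | yes refl = ≤-<-trans (∣leafNbrs∣≤1+ {F} {F₁} q (λ _ → old-or-q)) room
        ... | no  u≢r  = ≤-<-trans (∣leafNbrs∣-mono {F} {F₁} old) (few (stepF-⊆ {F} u∈F₁))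
          where
          old : ∀ {x} → Adj G u x → x ∈ Leaves G F₁ → x ∈ Leaves G F
          old ux x∈L₁ = [ id , (λ { refl → contradiction (nbr-of-q⇒≡r u∈F₁ (Adj-sym ux)) u≢r }) ]′ (old-or-q x∈L₁)

        -- q, now a leaf hanging at r, joins p's star. Then b ≥ 2 and r keeps a leaf neighbour w, so r is not
        -- isolated, and w, whose only neighbour is r, is the only vertex that may gain a leaf neighbour.
        module Crowded (crowded : b ≤ suc ∣ leafNbrs F r ∣) where

          F₂ : Subset n
          F₂ = F₁ ─ ⁅ q ⁆

          F₂⊆F₁ : F₂ ⊆ F₁
          F₂⊆F₁ = p─q⊆p F₁ ⁅ q ⁆

          q∈F : q ∈ F
          q∈F = stepF-⊆ {F} (proj₁ (∈Leaves⁻ {F₁} q∈L₁))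

          pq : Adj G p q
          pq = fresh⇒Adj fresh-q

          star₂ : Star F
          star₂ = record
            { centre = p ; rays = leafNbrs F p ∪ ⁅ q ⁆ ; centre-∈ = p∈F
            ; rays-⊆ = [ leafNbrs-⊆ {F} , (λ x∈⁅q⁆ → subst (_∈ F) (sym (x∈⁅y⁆⇒x≡y q x∈⁅q⁆)) q∈F) ]′
                       ∘ x∈p∪q⁻ _ ⁅ q ⁆
            ; rays-adj = [ proj₁ ∘ ∈leafNbrs⁻ {F} , (λ x∈⁅q⁆ → subst (Adj G p) (sym (x∈⁅y⁆⇒x≡y q x∈⁅q⁆)) pq) ]′
                         ∘ x∈p∪q⁻ _ ⁅ q ⁆
            ; rays-nonempty = let l , l∈Lp = Lp≢∅ in l , x∈p∪q⁺ (inj₁ l∈Lp)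
            ; ∣rays∣≤b = ≤-trans (p⊆q∪⁅x⁆⇒∣p∣≤1+∣q∣ {q = leafNbrs F p} q id) (few p∈F) }

          F─star₂≡F₂ : F ─ Star.vertices star₂ ≡ F₂
          F─star₂≡F₂ = begin
            F ─ (⁅ p ⁆ ∪ (leafNbrs F p ∪ ⁅ q ⁆)) ≡⟨ cong (F ─_) (sym (∪-assoc ⁅ p ⁆ (leafNbrs F p) ⁅ q ⁆)) ⟩
            F ─ ((⁅ p ⁆ ∪ leafNbrs F p) ∪ ⁅ q ⁆) ≡⟨ sym (p─q─r≡p─q∪r F (⁅ p ⁆ ∪ leafNbrs F p) ⁅ q ⁆) ⟩
            F₁ ─ ⁅ q ⁆                           ∎
            where open ≡-Reasoning

          2≤b : 2 ≤ b
          2≤b = ≤-trans (s≤s (Nonempty⇒0<∣p∣ Lp≢∅)) (few p∈F)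

          Lr≢∅ : Nonempty (leafNbrs F r)
          Lr≢∅ = 0<∣p∣⇒Nonempty (≤-pred (≤-trans 2≤b crowded))

          w : Fin n
          w = proj₁ Lr≢∅

          rw : Adj G r w
          rw = proj₁ (∈leafNbrs⁻ {F} (proj₂ Lr≢∅))

          w∈L : w ∈ Leaves G F
          w∈L = proj₂ (∈leafNbrs⁻ {F} (proj₂ Lr≢∅))

          p∉L : p ∉ Leaves G F
          p∉L p∈L =
            let l , l∈Lp = Lp≢∅
                pl , l∈L = ∈leafNbrs⁻ {F} l∈Lp
                q≡l = ∈Leaves⇒AtMostOneNbrIn p∈L q∈F (proj₁ (∈Leaves⁻ {F} l∈L)) pq pl
            in proj₂ fresh-q (subst (_∈ Leaves G F) (sym q≡l) l∈L)

          w∈F₂ : w ∈ F₂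
          w∈F₂ =
            let r∈F , r≢p , _ = ∈stepF⁻ {F} r∈F₁
                w∉Lp = λ w∈Lp → r≢p (leafNbr-only-nbr w∈Lp p∈F r∈F (Adj-sym rw))
                w≢p = λ w≡p → p∉L (subst (_∈ Leaves G F) w≡p w∈L)
                w≢q = λ w≡q → proj₂ fresh-q (subst (_∈ Leaves G F) w≡q w∈L)
            in x∈p∧x∉q⇒x∈p─q (∈stepF⁺ (proj₁ (∈Leaves⁻ {F} w∈L)) w≢p w∉Lp) (w≢q ∘ x∈⁅y⁆⇒x≡y q)

          noIso₂ : NoIsolated F₂
          noIso₂ {x} x∈F₂ with x∈p─q⁻ {q = ⁅ q ⁆} x∈F₂
          ... | x∈F₁ , x∉⁅q⁆ with NoIsolated-stepF noIso p∈F x∈F₁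
          ...   | y , y∈F₁ , xy with y ≟ᶠ q
          ...     | no  y≢q = y , x∈p∧x∉q⇒x∈p─q y∈F₁ (y≢q ∘ x∈⁅y⁆⇒x≡y q) , xy
          ...     | yes refl = w , w∈F₂ , subst (λ z → Adj G z w) (sym (nbr-of-q⇒≡r x∈F₁ (Adj-sym xy))) rw

          few₂ : FewLeafNbrs F₂
          few₂ {u} u∈F₂ with u ≟ᶠ w
          ... | yes refl = <-≤-trans (s≤s (∣leafNbrs∣≤1-of-leaf (stepF-⊆ {F} ∘ F₂⊆F₁) w∈L)) 2≤b
          ... | no  u≢w  = ≤-<-trans (∣leafNbrs∣-mono {F} {F₂} old) (few (stepF-⊆ {F} (F₂⊆F₁ u∈F₂)))
            where
            old : ∀ {x} → Adj G u x → x ∈ Leaves G F₂ → x ∈ Leaves G F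
            old {x} ux x∈L₂ with x∈p─q⁻ {q = ⁅ q ⁆} (proj₁ (∈Leaves⁻ {F₂} x∈L₂)) | Adj? q x
            ... | x∈F₁ , _ | yes qx with nbr-of-q⇒≡r x∈F₁ qx
            ...   | refl = contradiction (∈Leaves⇒AtMostOneNbrIn x∈L₂ u∈F₂ w∈F₂ (Adj-sym ux) rw) u≢w
            old {x} ux x∈L₂ | x∈F₁ , x∉⁅q⁆ | no ¬qx =
              [ id , (λ x≡q → contradiction x≡q (x∉⁅y⁆⇒x≢y x∉⁅q⁆)) ]′ (old-or-q x∈L₁)
              where
              stays : ∀ {y} → y ∈ F₁ → Adj G x y → y ∈ F₂
              stays y∈F₁ xy = x∈p∧x∉q⇒x∈p─q y∈F₁ λ y∈⁅q⁆ →
                ¬qx (subst (λ z → Adj G z x) (x∈⁅y⁆⇒x≡y q y∈⁅q⁆) (Adj-sym xy))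
              x∈L₁ : x ∈ Leaves G F₁
              x∈L₁ = ∈Leaves-restrict F₂⊆F₁ (proj₁ (∈Leaves⁻ {F₂} x∈L₂)) stays x∈L₂

      peel-star : Σ[ s ∈ Star F ] (NoIsolated (F ─ Star.vertices s) × FewLeafNbrs (F ─ Star.vertices s))
      peel-star with any? (λ x → x ∈? Leaves G F₁ ×-dec ¬? (x ∈? Leaves G F))
      ... | no ∄fresh = star₁ , NoIsolated-stepF noIso p∈F , no-fresh⇒few (λ fx → ∄fresh (_ , fx))
      ... | yes (q , fresh-q) with suc ∣ leafNbrs F (FreshLeaf.r fresh-q) ∣ <? b
      ...   | yes room = star₁ , NoIsolated-stepF noIso p∈F , FreshLeaf.few-if-room-at-r fresh-q room
      ...   | no ¬room = star₂ , subst (λ F′ → NoIsolated F′ × FewLeafNbrs F′) (sym F─star₂≡F₂) (noIso₂ , few₂)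
        where open FreshLeaf.Crowded fresh-q (≮⇒≥ ¬room)

    StarPartition-of-few : Acyclic G → ∀ k {F} → ∣ F ∣ < k → NoIsolated F → FewLeafNbrs F → StarPartition F
    StarPartition-of-few acyclic (suc k) {F} ∣F∣≤k noIso few with nonempty? F
    ... | no  F≡∅ = StarPartition-∅ (λ v∈F → F≡∅ (_ , v∈F))
    ... | yes F≢∅ =
      let p , p∈F , Lp≢∅ , one = peelable-vertex acyclic noIso F≢∅
          s , noIso′ , few′ = Peel.peel-star noIso few p∈F Lp≢∅ one
          ∣F′∣<k = <-≤-trans (Star.∣F─vertices∣<∣F∣ s) (≤-pred ∣F∣≤k)
      in StarPartition-extend s (StarPartition-of-few acyclic k ∣F′∣<k noIso′ few′)

    StarPartition-of-good : Acyclic G → 1 ≤ b → Good G b → ∀ k {F} vs → F ≡ down G vs → ∣ F ∣ < k → Unique vs →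
                            AdmissibleFrom G b Full vs → NoIsolated F → StarPartition F
    StarPartition-of-good acyclic 1≤b good (suc k) {F} vs refl ∣F∣≤k unique adm noIso
      with any? (λ v → v ∈? F ×-dec ∣ leafNbrs F v ∣ ≟ b)
    ... | yes (v , v∈F , ∣Lv∣≡b) =
      StarPartition-extend s
        (StarPartition-of-good acyclic 1≤b good k (vs ∷ʳ v) (sym (reduce-∷ʳ Full vs v))
          (<-≤-trans (Star.∣F─vertices∣<∣F∣ s) (≤-pred ∣F∣≤k)) (Unique-∷ʳ unique (λ v∈vs → ∈ₗ⇒∉reduce Full v∈vs v∈F))
          (AdmissibleFrom-∷ʳ Full vs adm ∣Lv∣≡b) (NoIsolated-stepF noIso v∈F))
      where
      s = leafNbrs-star v∈F (0<∣p∣⇒Nonempty (≤-trans 1≤b (≤-reflexive (sym ∣Lv∣≡b)))) (≤-reflexive ∣Lv∣≡b)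
    ... | no ∄v = StarPartition-of-few acyclic (suc k) ∣F∣≤k noIso few
      where
      few : FewLeafNbrs F
      few {u} u∈F with ∣ leafNbrs F u ∣ ≤? b
      ... | yes ≤b = ≤∧≢⇒< ≤b (λ ≡b → ∄v (u , u∈F , ≡b))
      ... | no  ≰b = contradiction (Unique-∷ʳ unique (λ u∈vs → ∈ₗ⇒∉reduce Full u∈vs u∈F) , (unique , adm) , ≰⇒> ≰b)
                                   (good vs u)

theorem1p5 : ∀ {n : ℕ} (G : SimpleGraph n) → IsTree G → 2 ≤ n → (b : ℕ) → 1 ≤ b →
    DominatorWinsStallerStart G b ⇔ Good G b
theorem1p5 G (connected , acyclic) 2≤n b 1≤b = mk⇔ (winning⇒Good G b 1≤b) λ good →
  let noIso = connected⇒NoIsolated G connected 2≤n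
  in pairing-strategy G b (StarPartition-of-good G b acyclic 1≤b good _ [] refl ≤-refl [] _ noIso)
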